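{- Let $\mathbf{S}$ be a hereditary closed set of positions of a ruleset. Suppose that for every position $G\in\mathbf{S}$, every pair $(G^L,G^R)\in G^{\mathcal{L}}\times G^{\mathcal{R}}$ satisfies the F2 property. Then every position $G\in\mathbf{S}$ is an integer.
   Context: We work in normal-play combinatorial game theory with short partizan games and the usual partial order $\leqslant$ on game values; "$G$ is an integer" means $G$ is equal in value to an integer. For a position $G$, $G^{\mathcal{L}}$ and $G^{\mathcal{R}}$ denote its sets of Left and Right options; for an option $G^L$, $G^{L\mathcal{R}}$ denotes the set of Right options of $G^L$, and for $G^R$, $G^{R\mathcal{L}}$ denotes the set of Left options of $G^R$. A set $\mathbf{S}$ of positions is a hereditary closed set of positions of a ruleset (HCR) if it is closed under taking options. For $G\in\mathbf{S}$, a pair $(G^L,G^R)\in G^{\mathcal{L}}\times G^{\mathcal{R}}$ satisfies the F2 property if there are $G^{LR}\in G^{L\mathcal{R}}$ and $G^{RL}\in G^{R\mathcal{L}}$ with $G^{RL}\geqslant G^{LR}$. (In particular the condition is vacuous when $G^{\mathcal{L}}$ or $G^{\mathcal{R}}$ is empty.) -}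

module Defs where

open import Data.List using (List; []; _∷_)
open import Data.List.Membership.Propositional using (_∈_)
open import Data.Product using (_×_; _,_; Σ; ∃; ∃-syntax)
open import Data.Unit using (⊤; tt)
open import Data.Empty using (⊥)
open import Data.Nat using (ℕ; zero; suc)
open import Data.Integer using (ℤ; +_; -[1+_])
open import Relation.Nullary using (¬_)

data Game : Set where
  ⟨_∣_⟩ : List Game → List Game → Game

Left : Game → List Game
Left ⟨ l ∣ r ⟩ = l

Right : Game → List Game
Right ⟨ l ∣ r ⟩ = r

mutual
  _≤G_ : Game → Game → Set
  ⟨ gl ∣ gr ⟩ ≤G ⟨ hl ∣ hr ⟩ = noLeftAbove gl ⟨ hl ∣ hr ⟩ × noRightBelow hr ⟨ gl ∣ gr ⟩

  noLeftAbove : List Game → Game → Set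
  noLeftAbove [] H = ⊤
  noLeftAbove (g ∷ gs) H = ¬ (H ≤G g) × noLeftAbove gs H

  noRightBelow : List Game → Game → Set
  noRightBelow [] G = ⊤
  noRightBelow (h ∷ hs) G = ¬ (h ≤G G) × noRightBelow hs G

_≈G_ : Game → Game → Set
G ≈G H = (G ≤G H) × (H ≤G G)

natGame : ℕ → Game
natGame zero = ⟨ [] ∣ [] ⟩
natGame (suc n) = ⟨ natGame n ∷ [] ∣ [] ⟩

negGame : ℕ → Game
negGame zero = ⟨ [] ∣ [] ⟩
negGame (suc n) = ⟨ [] ∣ negGame n ∷ [] ⟩

intGame : ℤ → Game
intGame (+ n) = natGame n
intGame -[1+ n ] = negGame (suc n)

IsInteger : Game → Set
IsInteger G = ∃[ n ] (G ≈G intGame n)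

Hereditary : (Game → Set) → Set
Hereditary S = ∀ G → S G →
  (∀ {GL} → GL ∈ Left G → S GL) × (∀ {GR} → GR ∈ Right G → S GR)

F2 : Game → Game → Set
F2 GL GR = ∃[ GLR ] ∃[ GRL ] (GLR ∈ Right GL × GRL ∈ Left GR × (GLR ≤G GRL))

{-# OPTIONS --safe #-}
-- By induction every position of S has an integer value n, recorded through the integers it
-- lies above and below.  If the options of G have values a (Left) and b (Right), F2 gives
-- a < G^{LR} ≤ G^{RL} < b in values, so a + 1 < b for every pair; then G compares with each
-- integer m exactly as the integer of least absolute value strictly between all the a's and
-- all the b's does, because a comparison G ≤ m only inspects the Left options of G and the
-- Right options of m.
module Submission where

open import Defs
open import Data.List using (List; []; _∷_; map)
open import Data.List.Membership.Propositional using (_∈_)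
open import Data.List.Relation.Unary.Any using (here; there)
open import Data.List.Relation.Unary.All as All using (All; []; _∷_)
open import Data.List.Relation.Unary.All.Properties using (map⁺; map⁻)
open import Data.Product using (_×_; _,_; ∃; ∃-syntax; proj₁; proj₂)
open import Data.Sum using (inj₁)
open import Data.Unit using (tt)
open import Data.Nat using (zero; suc; z≤n)
open import Data.Integer
  using (ℤ; +_; -[1+_]; 0ℤ; _≤_; _<_; +≤+; -≤+)
  renaming (suc to sucℤ; pred to predℤ)
open import Data.Integer.Properties
  using ( ≤-refl; ≤-trans; ≤-totalOrder; <⇒≱; ≰⇒>; ≤-<-trans; <-≤-trans
        ; suc[i]≤j⇒i<j; i<j⇒suc[i]≤j; i≤pred[j]⇒i<j; i<j⇒i≤pred[j])
open import Data.List.Extrema ≤-totalOrder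
  using (min; max; min≤⊤; min≤xs; v≤min⁺; xs≤max; max≤v⁺; v≤max⁺)
open import Function using (_∘_)
open import Relation.Nullary using (¬_)
open import Relation.Binary.PropositionalEquality using (refl)

noLeftAbove-∈ : ∀ {gs H g} → noLeftAbove gs H → g ∈ gs → ¬ H ≤G g
noLeftAbove-∈ {_ ∷ _} (¬H≤g , _) (here refl) = ¬H≤g
noLeftAbove-∈ {_ ∷ _} (_ , rest) (there p) = noLeftAbove-∈ rest p

noRightBelow-∈ : ∀ {hs G h} → noRightBelow hs G → h ∈ hs → ¬ h ≤G G
noRightBelow-∈ {_ ∷ _} (¬h≤G , _) (here refl) = ¬h≤G
noRightBelow-∈ {_ ∷ _} (_ , rest) (there p) = noRightBelow-∈ rest p

≤G-leftOption : ∀ {X Y x} → X ≤G Y → x ∈ Left X → ¬ Y ≤G x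
≤G-leftOption {⟨ _ ∣ _ ⟩} {⟨ _ ∣ _ ⟩} (noLeft , _) = noLeftAbove-∈ noLeft

≤G-rightOption : ∀ {X Y y} → X ≤G Y → y ∈ Right Y → ¬ y ≤G X
≤G-rightOption {⟨ _ ∣ _ ⟩} {⟨ _ ∣ _ ⟩} (_ , noRight) = noRightBelow-∈ noRight

mutual
  ≤G-trans : ∀ {A B C} → A ≤G B → B ≤G C → A ≤G C
  ≤G-trans {⟨ _ ∣ _ ⟩} {⟨ _ ∣ _ ⟩} {⟨ _ ∣ _ ⟩} A≤B@(noLeftᴬ , _) B≤C@(_ , noRightᶜ) =
    noLeftAbove-mono B≤C noLeftᴬ , noRightBelow-mono A≤B noRightᶜ

  noLeftAbove-mono : ∀ {gs B C} → B ≤G C → noLeftAbove gs B → noLeftAbove gs C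
  noLeftAbove-mono {[]} _ _ = tt
  noLeftAbove-mono {_ ∷ _} B≤C (¬B≤g , rest) =
    (λ C≤g → ¬B≤g (≤G-trans B≤C C≤g)) , noLeftAbove-mono B≤C rest

  noRightBelow-mono : ∀ {hs A B} → A ≤G B → noRightBelow hs B → noRightBelow hs A
  noRightBelow-mono {[]} _ _ = tt
  noRightBelow-mono {_ ∷ _} A≤B (¬h≤B , rest) =
    (λ h≤A → ¬h≤B (≤G-trans h≤A A≤B)) , noRightBelow-mono A≤B rest

-- For separated as < bs this is the integer of least absolute value strictly between them:
-- max as + 1 if that is positive, else min bs − 1 if that is negative, else 0.
simplestBetween : List ℤ → List ℤ → ℤ
simplestBetween as bs = max (min 0ℤ (map predℤ bs)) (map sucℤ as)

module _ (as bs : List ℤ) where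

  simplestBetween-aboveLeft : All (_< simplestBetween as bs) as
  simplestBetween-aboveLeft = All.map suc[i]≤j⇒i<j (map⁻ (xs≤max _ (map sucℤ as)))

  simplestBetween-belowRight : (∀ {a b} → a ∈ as → b ∈ bs → sucℤ a < b) →
    All (simplestBetween as bs <_) bs
  simplestBetween-belowRight separated = All.tabulate λ b∈bs →
    i≤pred[j]⇒i<j (max≤v⁺ (All.lookup (map⁻ (min≤xs 0ℤ (map predℤ bs))) b∈bs)
                          (map⁺ (All.tabulate λ a∈as → i<j⇒i≤pred[j] (separated a∈as b∈bs))))

  simplestBetween-minimal : ∀ {k} → 0ℤ ≤ k → All (_< k) as → simplestBetween as bs ≤ k
  simplestBetween-minimal 0≤k as<k =
    max≤v⁺ (≤-trans (min≤⊤ 0ℤ (map predℤ bs)) 0≤k) (map⁺ (All.map i<j⇒suc[i]≤j as<k))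

  simplestBetween-maximal : ∀ {m} → m ≤ 0ℤ → All (m <_) bs → m ≤ simplestBetween as bs
  simplestBetween-maximal m≤0 m<bs =
    ≤-trans (v≤min⁺ m≤0 (map⁺ (All.map i<j⇒i≤pred[j] m<bs))) (v≤max⁺ _ (map sucℤ as) (inj₁ ≤-refl))

-- Comparing with every integer, rather than just G ≈G intGame n, lets values transfer
-- along ≤G without any congruence lemma for replacing options by equal games.
record _hasValue_ (G : Game) (n : ℤ) : Set where
  field
    ≤intGame⇒≤ : ∀ {m} → G ≤G intGame m → n ≤ m
    ≤⇒≤intGame : ∀ {m} → n ≤ m → G ≤G intGame m
    intGame≤⇒≤ : ∀ {m} → intGame m ≤G G → m ≤ n
    ≤⇒intGame≤ : ∀ {m} → m ≤ n → intGame m ≤G G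
open _hasValue_

hasValue⇒IsInteger : ∀ {G n} → G hasValue n → IsInteger G
hasValue⇒IsInteger {n = n} G=n = n , ≤⇒≤intGame G=n ≤-refl , ≤⇒intGame≤ G=n ≤-refl

Valued : Game → Set
Valued G = ∃ (G hasValue_)

values : ∀ {gs} → All Valued gs → List ℤ
values [] = []
values ((n , _) ∷ vs) = n ∷ values vs

∈-values⁻ : ∀ {gs n} (vs : All Valued gs) → n ∈ values vs → ∃[ g ] (g ∈ gs × g hasValue n)
∈-values⁻ ((_ , g=n) ∷ _) (here refl) = _ , here refl , g=n
∈-values⁻ (_ ∷ vs) (there p) with ∈-values⁻ vs p
... | g , g∈gs , g=n = g , there g∈gs , g=n

module _ {m : ℤ} where

  noLeftAbove-intGame⁺ : ∀ {gs} (vs : All Valued gs) → All (_< m) (values vs) → noLeftAbove gs (intGame m)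
  noLeftAbove-intGame⁺ [] [] = tt
  noLeftAbove-intGame⁺ ((_ , g=a) ∷ vs) (a<m ∷ rest) =
    (λ m≤g → <⇒≱ a<m (intGame≤⇒≤ g=a m≤g)) , noLeftAbove-intGame⁺ vs rest

  noLeftAbove-intGame⁻ : ∀ {gs} (vs : All Valued gs) → noLeftAbove gs (intGame m) → All (_< m) (values vs)
  noLeftAbove-intGame⁻ [] _ = []
  noLeftAbove-intGame⁻ ((_ , g=a) ∷ vs) (¬m≤g , rest) =
    ≰⇒> (¬m≤g ∘ ≤⇒intGame≤ g=a) ∷ noLeftAbove-intGame⁻ vs rest

  noRightBelow-intGame⁺ : ∀ {hs} (vs : All Valued hs) → All (m <_) (values vs) → noRightBelow hs (intGame m)
  noRightBelow-intGame⁺ [] [] = tt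
  noRightBelow-intGame⁺ ((_ , h=b) ∷ vs) (m<b ∷ rest) =
    (λ h≤m → <⇒≱ m<b (≤intGame⇒≤ h=b h≤m)) , noRightBelow-intGame⁺ vs rest

  noRightBelow-intGame⁻ : ∀ {hs} (vs : All Valued hs) → noRightBelow hs (intGame m) → All (m <_) (values vs)
  noRightBelow-intGame⁻ [] _ = []
  noRightBelow-intGame⁻ ((_ , h=b) ∷ vs) (¬h≤m , rest) =
    ≰⇒> (¬h≤m ∘ ≤⇒≤intGame h=b) ∷ noRightBelow-intGame⁻ vs rest

module _ {l r : List Game} (vl : All Valued l) (vr : All Valued r) {n : ℤ}
  (leftValues<n : All (_< n) (values vl)) (n<rightValues : All (n <_) (values vr))
  (minimal : ∀ {k} → 0ℤ ≤ k → All (_< k) (values vl) → n ≤ k)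
  (maximal : ∀ {m} → m ≤ 0ℤ → All (m <_) (values vr) → m ≤ n)
  where

  private
    G : Game
    G = ⟨ l ∣ r ⟩

    noLeftAbove-≥ : ∀ {m} → n ≤ m → noLeftAbove l (intGame m)
    noLeftAbove-≥ n≤m = noLeftAbove-intGame⁺ vl (All.map (λ a<n → <-≤-trans a<n n≤m) leftValues<n)

    noRightBelow-≤ : ∀ {m} → m ≤ n → noRightBelow r (intGame m)
    noRightBelow-≤ m≤n = noRightBelow-intGame⁺ vr (All.map (λ n<b → ≤-<-trans m≤n n<b) n<rightValues)

    ≤nat⇒ : ∀ k → G ≤G natGame k → n ≤ + k
    ≤nat⇒ zero (noLeft , _) = minimal (+≤+ z≤n) (noLeftAbove-intGame⁻ vl noLeft)
    ≤nat⇒ (suc k) (noLeft , _) = minimal (+≤+ z≤n) (noLeftAbove-intGame⁻ vl noLeft)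

    ≤nat⇐ : ∀ k → n ≤ + k → G ≤G natGame k
    ≤nat⇐ zero n≤k = noLeftAbove-≥ n≤k , tt
    ≤nat⇐ (suc k) n≤k = noLeftAbove-≥ n≤k , tt

    nat≤⇒ : ∀ k → natGame k ≤G G → + k ≤ n
    nat≤⇒ zero (_ , noRight) = maximal ≤-refl (noRightBelow-intGame⁻ vr noRight)
    nat≤⇒ (suc k) ((¬G≤k , _) , _) = i<j⇒suc[i]≤j (≰⇒> (¬G≤k ∘ ≤nat⇐ k))

    nat≤⇐ : ∀ k → + k ≤ n → natGame k ≤G G
    nat≤⇐ zero 0≤n = tt , noRightBelow-≤ 0≤n
    nat≤⇐ (suc k) k+1≤n =
      ((λ G≤k → <⇒≱ (suc[i]≤j⇒i<j k+1≤n) (≤nat⇒ k G≤k)) , tt) , noRightBelow-≤ k+1≤n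

    neg≤⇒ : ∀ j → negGame (suc j) ≤G G → -[1+ j ] ≤ n
    neg≤⇒ j (_ , noRight) = maximal -≤+ (noRightBelow-intGame⁻ vr noRight)

    neg≤⇐ : ∀ j → -[1+ j ] ≤ n → negGame (suc j) ≤G G
    neg≤⇐ j m≤n = tt , noRightBelow-≤ m≤n

    ≤neg⇒ : ∀ j → G ≤G negGame (suc j) → n ≤ -[1+ j ]
    ≤neg⇒ zero (_ , ¬0≤G , _) = i<j⇒i≤pred[j] (≰⇒> (¬0≤G ∘ nat≤⇐ zero))
    ≤neg⇒ (suc j) (_ , ¬m+1≤G , _) = i<j⇒i≤pred[j] (≰⇒> (¬m+1≤G ∘ neg≤⇐ j))

    ≤neg⇐ : ∀ j → n ≤ -[1+ j ] → G ≤G negGame (suc j)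
    ≤neg⇐ zero n≤m = noLeftAbove-≥ n≤m , (<⇒≱ (i≤pred[j]⇒i<j n≤m) ∘ nat≤⇒ zero) , tt
    ≤neg⇐ (suc j) n≤m = noLeftAbove-≥ n≤m , (<⇒≱ (i≤pred[j]⇒i<j n≤m) ∘ neg≤⇒ j) , tt

    ≤intGame⇒ : ∀ m → G ≤G intGame m → n ≤ m
    ≤intGame⇒ (+ k) = ≤nat⇒ k
    ≤intGame⇒ -[1+ j ] = ≤neg⇒ j

    ≤intGame⇐ : ∀ m → n ≤ m → G ≤G intGame m
    ≤intGame⇐ (+ k) = ≤nat⇐ k
    ≤intGame⇐ -[1+ j ] = ≤neg⇐ j

    intGame≤⇒ : ∀ m → intGame m ≤G G → m ≤ n
    intGame≤⇒ (+ k) = nat≤⇒ k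
    intGame≤⇒ -[1+ j ] = neg≤⇒ j

    intGame≤⇐ : ∀ m → m ≤ n → intGame m ≤G G
    intGame≤⇐ (+ k) = nat≤⇐ k
    intGame≤⇐ -[1+ j ] = neg≤⇐ j

  options⇒hasValue : ⟨ l ∣ r ⟩ hasValue n
  options⇒hasValue = record
    { ≤intGame⇒≤ = ≤intGame⇒ _ ; ≤⇒≤intGame = ≤intGame⇐ _
    ; intGame≤⇒≤ = intGame≤⇒ _ ; ≤⇒intGame≤ = intGame≤⇐ _ }

options⇒hasSimplestValue : ∀ {l r} (vl : All Valued l) (vr : All Valued r) →
  (∀ {a b} → a ∈ values vl → b ∈ values vr → sucℤ a < b) →
  ⟨ l ∣ r ⟩ hasValue simplestBetween (values vl) (values vr)
options⇒hasSimplestValue vl vr separated = options⇒hasValue vl vr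
  (simplestBetween-aboveLeft as bs) (simplestBetween-belowRight as bs separated)
  (simplestBetween-minimal as bs) (simplestBetween-maximal as bs)
  where
  as bs : List ℤ
  as = values vl
  bs = values vr

F2⇒separated : ∀ {GL GR a b} → GL hasValue a → GR hasValue b →
  (∀ {x} → x ∈ Right GL → Valued x) → (∀ {y} → y ∈ Left GR → Valued y) →
  F2 GL GR → sucℤ a < b
F2⇒separated {a = a} {b} GL=a GR=b valuedʳ valuedˡ (GLR , GRL , GLR∈ , GRL∈ , GLR≤GRL)
  with valuedʳ GLR∈ | valuedˡ GRL∈
... | c , GLR=c | d , GRL=d = ≤-<-trans (≤-trans (i<j⇒suc[i]≤j a<c) c≤d) d<b
  where
  a<c : a < c
  a<c = ≰⇒> (≤G-rightOption (≤⇒intGame≤ GL=a ≤-refl) GLR∈ ∘ ≤⇒≤intGame GLR=c)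
  c≤d : c ≤ d
  c≤d = intGame≤⇒≤ GRL=d (≤G-trans (≤⇒intGame≤ GLR=c ≤-refl) GLR≤GRL)
  d<b : d < b
  d<b = ≰⇒> (≤G-leftOption (≤⇒≤intGame GR=b ≤-refl) GRL∈ ∘ ≤⇒intGame≤ GRL=d)

Game-ind : (P : Game → Set) → (∀ {l r} → All P l → All P r → P ⟨ l ∣ r ⟩) → ∀ G → P G
Game-ind P step = ind
  where
  mutual
    ind : ∀ G → P G
    ind ⟨ l ∣ r ⟩ = step (indAll l) (indAll r)

    indAll : ∀ gs → All P gs
    indAll [] = []
    indAll (g ∷ gs) = ind g ∷ indAll gs

module _ (S : Game → Set) (hereditary : Hereditary S)
  (f2 : ∀ G → S G → ∀ {GL GR} → GL ∈ Left G → GR ∈ Right G → F2 GL GR) where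

  ValuedOn : Game → Set
  ValuedOn G = S G → Valued G

  -- F2 speaks about options of options, so the induction also carries the options' values.
  ValuedOnWithOptions : Game → Set
  ValuedOnWithOptions G = ValuedOn G × All ValuedOn (Left G) × All ValuedOn (Right G)

  ValuedWithOptions : Game → Set
  ValuedWithOptions G = Valued G × (∀ {x} → x ∈ Left G → Valued x) × (∀ {y} → y ∈ Right G → Valued y)

  valuedWithOptions : ∀ {G} → S G → ValuedOnWithOptions G → ValuedWithOptions G
  valuedWithOptions {G} s (valued , valuedˡ , valuedʳ) =
    valued s ,
    (λ p → All.lookup valuedˡ p (proj₁ (hereditary G s) p)) ,
    (λ q → All.lookup valuedʳ q (proj₂ (hereditary G s) q))

  valuedOn-step : ∀ {l r} → All ValuedOnWithOptions l → All ValuedOnWithOptions r → ValuedOn ⟨ l ∣ r ⟩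
  valuedOn-step {l} {r} ihˡ ihʳ s = _ , options⇒hasSimplestValue vl vr separated
    where
    leftOption : ∀ {g} → g ∈ l → ValuedWithOptions g
    leftOption p = valuedWithOptions (proj₁ (hereditary _ s) p) (All.lookup ihˡ p)

    rightOption : ∀ {h} → h ∈ r → ValuedWithOptions h
    rightOption q = valuedWithOptions (proj₂ (hereditary _ s) q) (All.lookup ihʳ q)

    vl : All Valued l
    vl = All.tabulate (proj₁ ∘ leftOption)

    vr : All Valued r
    vr = All.tabulate (proj₁ ∘ rightOption)

    separated : ∀ {a b} → a ∈ values vl → b ∈ values vr → sucℤ a < b
    separated a∈ b∈ with ∈-values⁻ vl a∈ | ∈-values⁻ vr b∈
    ... | _ , p , g=a | _ , q , h=b =
      F2⇒separated g=a h=b (proj₂ (proj₂ (leftOption p))) (proj₁ (proj₂ (rightOption q))) (f2 _ s p q)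

  valuedOnWithOptions : ∀ G → ValuedOnWithOptions G
  valuedOnWithOptions = Game-ind ValuedOnWithOptions λ ihˡ ihʳ →
    valuedOn-step ihˡ ihʳ , All.map proj₁ ihˡ , All.map proj₁ ihʳ

mainTheorem5 : (S : Game → Set) → Hereditary S →
    (∀ G → S G → ∀ {GL GR} → GL ∈ Left G → GR ∈ Right G → F2 GL GR) →
    ∀ G → S G → IsInteger G
mainTheorem5 S hereditary f2 G s =
  hasValue⇒IsInteger (proj₂ (proj₁ (valuedOnWithOptions S hereditary f2 G) s))
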